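{- Let $\mathcal{U}$ be a finite ground set with $n=|\mathcal{U}|$, $f:2^{\mathcal{U}}\to\mathbb{R}_{\ge0}$ monotone and $\gamma$-submodular with $\gamma\in(0,1]$, $c:\mathcal{U}\to\mathbb{R}_{>0}$ modular, $\kappa>0$, and $\delta,\varepsilon>0$. Suppose QuickPrune-Single is run on $(f,\mathcal{U},c,\kappa)$ with parameters $\delta,\varepsilon$, and let $\hat A$ be the union of all values ever taken by the variable $A$ during the run (i.e. all elements ever added to $A$). Then $f(\hat A)\ge \mathrm{OPT}/(1+\gamma^{ -1}\delta)$, where $\mathrm{OPT}=\max_{S\subseteq\mathcal{U}:\,c(S)\le\kappa}f(S)$.
   Context: For $S,T\subseteq\mathcal{U}$, $\Delta(T\mid S)=f(S\cup T)-f(S)$; $S+e=S\cup\{e\}$; $f(e)=f(\{e\})$; $c(S)=\sum_{s\in S}c(s)$. $f$ is monotone if $S\subseteq T$ implies $f(S)\le f(T)$. A monotone $f$ is $\gamma$-submodular if $\gamma$ is the maximum value in $[0,1]$ such that for all $S\subseteq T\subseteq\mathcal{U}$ and $x\notin T$, $\gamma\,\Delta(x\mid T)\le\Delta(x\mid S)$. QuickPrune-Single$(f,\mathcal{U},c,\kappa,\delta,\varepsilon)$: initialize $A\gets\emptyset$, $a^*\gets\emptyset$, $A_s\gets\emptyset$. For each $e\in\mathcal{U}$ in turn (a fixed order): if $c(e)>\kappa$, skip to the next element; otherwise (i) if $\Delta(e\mid A)\ge \delta c(e)f(A)/\kappa$, set $A\gets A+e$; (ii) if $f(e)>f(a^*)$,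 set $a^*\gets e$; (iii) if $f(A)>\frac{n}{\varepsilon}f(A_s)$, set $A\gets A\setminus A_s$ and then $A_s\gets A$. After all elements, return $A\cup a^*$.
   Formalization: The values of f and c and the numbers κ, δ, ε and γ are rationals instead of reals. -}

module Defs where

open import Data.Nat using (ℕ)
open import Data.Bool using (Bool; true; false; if_then_else_)
open import Data.Fin using (Fin; zero; suc)
open import Data.Fin.Subset using (Subset; ⊥; ⁅_⁆; _∈_; _∉_; _⊆_; _∪_; _─_)
open import Data.Vec using (Vec; []; _∷_; lookup)
open import Data.List using (List; foldl; allFin)
open import Data.Product using (_×_; _,_)
open import Relation.Nullary using (does)
open import Data.Rational using (ℚ; 0ℚ; 1ℚ; _+_; _-_; _*_; _÷_; _≤_; _<_; positive)
open import Data.Rational.Properties using (_≤?_; _<?_; pos⇒nonZero)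
import Data.Integer as ℤ
open import Data.Rational using (_/_)

nℚ : ℕ → ℚ
nℚ n = ℤ.+ n / 1

cost : ∀ {n} → (Fin n → ℚ) → Subset n → ℚ
cost {ℕ.zero}  c []          = 0ℚ
cost {ℕ.suc n} c (b ∷ S) =
  (if b then c zero else 0ℚ) + cost (λ i → c (suc i)) S

Δ : ∀ {n} → (Subset n → ℚ) → Subset n → Subset n → ℚ
Δ f T S = f (S ∪ T) - f S

Monotone : ∀ {n} → (Subset n → ℚ) → Set
Monotone f = ∀ S T → S ⊆ T → f S ≤ f T

SubmodRatioHolds : ∀ {n} → (Subset n → ℚ) → ℚ → Set
SubmodRatioHolds f γ =
  ∀ S T x → S ⊆ T → x ∉ T → γ * Δ f ⁅ x ⁆ T ≤ Δ f ⁅ x ⁆ S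

IsGammaSubmodular : ∀ {n} → (Subset n → ℚ) → ℚ → Set
IsGammaSubmodular f γ =
  Monotone f × (0ℚ ≤ γ) × (γ ≤ 1ℚ) × SubmodRatioHolds f γ ×
  (∀ γ′ → 0ℚ ≤ γ′ → γ′ ≤ 1ℚ → SubmodRatioHolds f γ′ → γ′ ≤ γ)

-- state of QuickPrune-Single: (A , a* , A_s , Â) where Â is the union of
-- all values ever taken by A
record State (n : ℕ) : Set where
  constructor st
  field
    A    : Subset n
    aStar : Subset n
    As   : Subset n
    Ahat : Subset n

open State public

step : ∀ {n} (f : Subset n → ℚ) (c : Fin n → ℚ) (κ δ ε : ℚ) →
       0ℚ < κ → 0ℚ < ε → State n → Fin n → State n
step {n} f c κ δ ε κ>0 ε>0 s e =
  if does (κ <? c e) then s else s₃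
  where
    instance
      nzκ = pos⇒nonZero κ {{positive κ>0}}
      nzε = pos⇒nonZero ε {{positive ε>0}}
    A₁ : Subset n
    A₁ = if does ((δ * c e * f (A s)) ÷ κ ≤? Δ f ⁅ e ⁆ (A s))
           then A s ∪ ⁅ e ⁆ else A s
    a₁ : Subset n
    a₁ = if does (f (aStar s) <? f ⁅ e ⁆) then ⁅ e ⁆ else aStar s
    s₃ : State n
    s₃ = if does ((nℚ n ÷ ε) * f (As s) <? f A₁)
           then st (A₁ ─ As s) a₁ (A₁ ─ As s) (Ahat s ∪ A₁)
           else st A₁ a₁ (As s) (Ahat s ∪ A₁)

initial : ∀ {n} → State n
initial = st ⊥ ⊥ ⊥ ⊥

run : ∀ {n} (f : Subset n → ℚ) (c : Fin n → ℚ) (κ δ ε : ℚ) →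
      0ℚ < κ → 0ℚ < ε → State n
run {n} f c κ δ ε κ>0 ε>0 = foldl (step f c κ δ ε κ>0 ε>0) initial (allFin n)

output : ∀ {n} (f : Subset n → ℚ) (c : Fin n → ℚ) (κ δ ε : ℚ) →
         0ℚ < κ → 0ℚ < ε → Subset n
output f c κ δ ε p q = A r ∪ aStar r where r = run f c κ δ ε p q

Ahat-run : ∀ {n} (f : Subset n → ℚ) (c : Fin n → ℚ) (κ δ ε : ℚ) →
           0ℚ < κ → 0ℚ < ε → Subset n
Ahat-run f c κ δ ε p q = Ahat (run f c κ δ ε p q)

{-# OPTIONS --safe #-}
module Submission where

open import Defs
open import Data.Bool using (true; false; if_then_else_)
open import Data.Fin using (Fin; zero; suc)
open import Data.Fin.Subset using (Subset; ⁅_⁆; _∈_; _⊆_; _∪_; _─_; inside; outside)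
open import Data.Fin.Subset.Properties
  using (_∈?_; x∈⁅x⁆; x∈⁅y⁆⇒x≡y; x∈p∪q⁻; p⊆p∪q; q⊆p∪q; p─q⊆p; ⊆-refl; ⊆-reflexive; ⊆-trans; ⊆-antisym;
         ∪-assoc; ∪-identityˡ; out⊆; s⊆s)
open import Data.List using ([]; _∷_; foldl; allFin)
import Data.List.Relation.Unary.Any as Any
open import Data.List.Membership.Propositional using () renaming (_∈_ to _∈ₗ_)
open import Data.List.Membership.Propositional.Properties using (∈-allFin)
open import Data.Nat using (ℕ)
open import Data.Product using (_×_; _,_; ∃-syntax)
open import Data.Rational using (ℚ; 0ℚ; 1ℚ; _+_; _-_; _*_; 1/_; _÷_; _≤_; _<_; NonZero; Positive; positive; nonNegative)
open import Data.Rational.Properties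
open import Data.Rational.Solver using (module +-*-Solver)
open import Data.Sum using (_⊎_; inj₁; inj₂; [_,_])
open import Data.Vec using ([]; _∷_; here; there)
open import Function using (id; _∘_)
open import Relation.Binary.PropositionalEquality using (_≡_; refl; sym; trans; cong; subst; module ≡-Reasoning)
open import Relation.Nullary using (¬_; Dec; does; yes; no; contradiction)
open import Relation.Nullary.Decidable using (dec-true; dec-false)
open +-*-Solver using (solve; _:+_; _:*_; _:-_; _:=_; con)

-- Every element e of a feasible set S either ends up in Â, or was rejected by test (i)
-- at a moment when A ⊆ Â (step (iii) only removes elements from A, and Â records every
-- value of A), so that Δ(e | A) < δ c(e) f(A)/κ ≤ δ c(e) f(Â)/κ.  By γ-submodularity the
-- gain of e over any superset of Â is then at most (δ/γ) (f(Â)/κ) c(e).  Adding up these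
-- gains along S gives f(Â ∪ S) − f(Â) ≤ (δ/γ) (f(Â)/κ) c(S) ≤ (δ/γ) f(Â), and
-- f(S) ≤ f(Â ∪ S) by monotonicity.

p≤q+p : ∀ {p q} → 0ℚ ≤ q → p ≤ q + p
p≤q+p {p} {q} 0≤q = subst (_≤ q + p) (+-identityˡ p) (+-monoˡ-≤ p 0≤q)

p≤p+q : ∀ {p q} → 0ℚ ≤ q → p ≤ p + q
p≤p+q {p} {q} 0≤q = subst (p ≤_) (+-comm q p) (p≤q+p 0≤q)

0≤p*q : ∀ {p q} → 0ℚ ≤ p → 0ℚ ≤ q → 0ℚ ≤ p * q
0≤p*q {p} {q} 0≤p 0≤q = nonNegative⁻¹ (p * q) {{nonNeg*nonNeg⇒nonNeg p {{nonNegative 0≤p}} q {{nonNegative 0≤q}}}}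

1/pos≥0 : ∀ p .{{_ : Positive p}} → 0ℚ ≤ (1/ p) {{pos⇒nonZero p}}
1/pos≥0 p = <⇒≤ (positive⁻¹ _ {{1/pos⇒pos p}})

p*[q÷r]*r≡p*q : ∀ p q r .{{_ : NonZero r}} → p * (q ÷ r) * r ≡ p * q
p*[q÷r]*r≡p*q p q r = begin
  p * (q * 1/ r) * r   ≡⟨ solve 4 (λ p q r⁻¹ r → p :* (q :* r⁻¹) :* r := p :* q :* (r⁻¹ :* r)) refl p q (1/ r) r ⟩
  p * q * (1/ r * r)   ≡⟨ cong (p * q *_) (*-inverseˡ r) ⟩
  p * q * 1ℚ           ≡⟨ *-identityʳ (p * q) ⟩
  p * q                ∎
  where open ≡-Reasoning

if-elim : ∀ {a p} {X : Set a} (P : X → Set p) b {x y} → P x → P y → P (if b then x else y)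
if-elim P true  px py = px
if-elim P false px py = py

≤⇒≯ : ∀ {p q} → p ≤ q → ¬ q < p
≤⇒≯ p≤q q<p = <-irrefl refl (≤-<-trans p≤q q<p)

x∈p⇒⁅x⁆⊆p : ∀ {n} {x : Fin n} {p} → x ∈ p → ⁅ x ⁆ ⊆ p
x∈p⇒⁅x⁆⊆p {x = x} {p} x∈p y∈⁅x⁆ = subst (_∈ p) (sym (x∈⁅y⁆⇒x≡y x y∈⁅x⁆)) x∈p

q⊆p⇒p∪q≡p : ∀ {n} {p q : Subset n} → q ⊆ p → p ∪ q ≡ p
q⊆p⇒p∪q≡p {p = p} {q} q⊆p = ⊆-antisym (λ x∈ → [ id , q⊆p ] (x∈p∪q⁻ p q x∈)) (p⊆p∪q q)

module _ {n} (f : Subset n → ℚ) where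

  Δ-∪ : ∀ U V T → Δ f (U ∪ V) T ≡ Δ f U T + Δ f V (T ∪ U)
  Δ-∪ U V T = begin
    f (T ∪ (U ∪ V)) - f T
      ≡⟨ cong (λ X → f X - f T) (sym (∪-assoc T U V)) ⟩
    f ((T ∪ U) ∪ V) - f T
      ≡⟨ solve 3 (λ a b c → a :- c := (b :- c) :+ (a :- b)) refl (f ((T ∪ U) ∪ V)) (f (T ∪ U)) (f T) ⟩
    (f (T ∪ U) - f T) + (f ((T ∪ U) ∪ V) - f (T ∪ U)) ∎
    where open ≡-Reasoning

  Δ-⊆ : ∀ {S T} → S ⊆ T → Δ f S T ≡ 0ℚ
  Δ-⊆ {S} {T} S⊆T = trans (cong (λ X → f X - f T) (q⊆p⇒p∪q≡p S⊆T)) (+-inverseʳ (f T))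

Δ-outside∷ : ∀ {n} (f : Subset (ℕ.suc n) → ℚ) t S T → Δ f (outside ∷ S) (t ∷ T) ≡ Δ (f ∘ (t ∷_)) S T
Δ-outside∷ f true  S T = refl
Δ-outside∷ f false S T = refl

cost-nonNeg : ∀ {n} {c : Fin n → ℚ} → (∀ e → 0ℚ ≤ c e) → ∀ S → 0ℚ ≤ cost c S
cost-nonNeg c≥0 []            = ≤-refl
cost-nonNeg c≥0 (outside ∷ S) = +-mono-≤ ≤-refl (cost-nonNeg (c≥0 ∘ suc) S)
cost-nonNeg c≥0 (inside  ∷ S) = +-mono-≤ (c≥0 zero) (cost-nonNeg (c≥0 ∘ suc) S)

∈⇒≤cost : ∀ {n} {c : Fin n → ℚ} → (∀ e → 0ℚ ≤ c e) → ∀ {e S} → e ∈ S → c e ≤ cost c S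
∈⇒≤cost c≥0 {S = inside  ∷ S} here        = p≤p+q (cost-nonNeg (c≥0 ∘ suc) S)
∈⇒≤cost c≥0 {S = inside  ∷ S} (there e∈S) = ≤-trans (∈⇒≤cost (c≥0 ∘ suc) e∈S) (p≤q+p (c≥0 zero))
∈⇒≤cost c≥0 {S = outside ∷ S} (there e∈S) = ≤-trans (∈⇒≤cost (c≥0 ∘ suc) e∈S) (p≤q+p ≤-refl)

CostBoundedGains : ∀ {n} → (Subset n → ℚ) → (Fin n → ℚ) → ℚ → Subset n → Subset n → Set
CostBoundedGains f c K T S = ∀ {e} → e ∈ S → ∀ {T′} → T ⊆ T′ → Δ f ⁅ e ⁆ T′ ≤ K * c e

CostBoundedGains-mono : ∀ {n} {f : Subset n → ℚ} {c K T T′ S S′} →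
  T ⊆ T′ → S′ ⊆ S → CostBoundedGains f c K T S → CostBoundedGains f c K T′ S′
CostBoundedGains-mono T⊆T′ S′⊆S bound e∈S′ T′⊆T″ = bound (S′⊆S e∈S′) (⊆-trans T⊆T′ T′⊆T″)

-- Induction along the vector S, as in the definition of cost: the first element is split
-- off by Δ-∪, and the rest is a gain of f ∘ (t ∷_), the restriction of f to subsets with
-- first coordinate t.
mutual
  Δ≤*cost : ∀ {n} (f : Subset n → ℚ) c K T S → CostBoundedGains f c K T S → Δ f S T ≤ K * cost c S
  Δ≤*cost f c K [] [] _ = ≤-reflexive (trans (+-inverseʳ (f [])) (sym (*-zeroʳ K)))
  Δ≤*cost f c K (t ∷ T) (outside ∷ S) bound = begin
    Δ f (outside ∷ S) (t ∷ T)   ≤⟨ Δ≤*cost-outside∷ f c K t T S bound ⟩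
    K * cost (c ∘ suc) S        ≡⟨ cong (K *_) (sym (+-identityˡ _)) ⟩
    K * (0ℚ + cost (c ∘ suc) S) ∎
    where open ≤-Reasoning
  Δ≤*cost f c K T@(_ ∷ _) (inside ∷ S) bound = begin
    Δ f (inside ∷ S) T                                ≡⟨ cong (λ U → Δ f (inside ∷ U) T) (sym (∪-identityˡ S)) ⟩
    Δ f (⁅ zero ⁆ ∪ (outside ∷ S)) T                  ≡⟨ Δ-∪ f ⁅ zero ⁆ (outside ∷ S) T ⟩
    Δ f ⁅ zero ⁆ T + Δ f (outside ∷ S) (T ∪ ⁅ zero ⁆) ≤⟨ +-mono-≤ (bound here ⊆-refl) (Δ≤*cost-outside∷ f c K _ _ S bound′) ⟩
    K * c zero + K * cost (c ∘ suc) S                 ≡⟨ sym (*-distribˡ-+ K _ _) ⟩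
    K * (c zero + cost (c ∘ suc) S)                   ∎
    where
    open ≤-Reasoning
    bound′ : CostBoundedGains f c K (T ∪ ⁅ zero ⁆) (outside ∷ S)
    bound′ = CostBoundedGains-mono {f = f} {c} {K} (p⊆p∪q ⁅ zero ⁆) (out⊆ ⊆-refl) bound

  Δ≤*cost-outside∷ : ∀ {n} (f : Subset (ℕ.suc n) → ℚ) c K t T S → CostBoundedGains f c K (t ∷ T) (outside ∷ S) →
    Δ f (outside ∷ S) (t ∷ T) ≤ K * cost (c ∘ suc) S
  Δ≤*cost-outside∷ f c K t T S bound = begin
    Δ f (outside ∷ S) (t ∷ T) ≡⟨ Δ-outside∷ f t S T ⟩
    Δ (f ∘ (t ∷_)) S T        ≤⟨ Δ≤*cost (f ∘ (t ∷_)) (c ∘ suc) K T S bound′ ⟩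
    K * cost (c ∘ suc) S      ∎
    where
    open ≤-Reasoning
    bound′ : CostBoundedGains (f ∘ (t ∷_)) (c ∘ suc) K T S
    bound′ {e} e∈S {T′} T⊆T′ = subst (_≤ K * c (suc e)) (Δ-outside∷ f t ⁅ e ⁆ T′) (bound (there e∈S) (s⊆s T⊆T′))

module Threshold {n} (f : Subset n → ℚ) (c : Fin n → ℚ) (κ δ : ℚ) .{{_ : Positive κ}} where

  instance
    κ≢0 : NonZero κ
    κ≢0 = pos⇒nonZero κ

  Admits : Subset n → Fin n → Set
  Admits B e = (δ * c e * f B) ÷ κ ≤ Δ f ⁅ e ⁆ B

  Covered : Subset n → Fin n → Set
  Covered T e = e ∈ T ⊎ ∃[ B ] B ⊆ T × ¬ Admits B e

  Covered-mono : ∀ {T T′ e} → T ⊆ T′ → Covered T e → Covered T′ e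
  Covered-mono T⊆T′ (inj₁ e∈T)              = inj₁ (T⊆T′ e∈T)
  Covered-mono T⊆T′ (inj₂ (B , B⊆T , ¬adm)) = inj₂ (B , ⊆-trans B⊆T T⊆T′ , ¬adm)

  gainRate : (γ : ℚ) .{{_ : Positive γ}} → Subset n → ℚ
  gainRate γ T = (δ ÷ γ) {{pos⇒nonZero γ}} * (f T ÷ κ)

  gainRate≥0 : ∀ {γ T} .{{_ : Positive γ}} → 0ℚ ≤ δ → 0ℚ ≤ f T → 0ℚ ≤ gainRate γ T
  gainRate≥0 {γ} δ≥0 fT≥0 = 0≤p*q (0≤p*q δ≥0 (1/pos≥0 γ)) (0≤p*q fT≥0 (1/pos≥0 κ))

  Covered⇒CostBoundedGains : ∀ {γ T S} .{{_ : Positive γ}} → Monotone f → SubmodRatioHolds f γ →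
    0ℚ ≤ δ → 0ℚ ≤ f T → (∀ e → 0ℚ ≤ c e) → (∀ {e} → e ∈ S → Covered T e) →
    CostBoundedGains f c (gainRate γ T) T S
  Covered⇒CostBoundedGains {γ} {T} mono ratio δ≥0 fT≥0 c≥0 covered {e} e∈S {T′} T⊆T′ =
    gain≤ (e ∈? T′) (covered e∈S)
    where
    instance
      γ≢0 : NonZero γ
      γ≢0 = pos⇒nonZero γ
    K : ℚ
    K = gainRate γ T
    cancel-γ : (δ * c e * f T) ÷ κ ≡ γ * (K * c e)
    cancel-γ = begin
      δ * c e * f T * 1/ κ
        ≡⟨ sym (*-identityˡ _) ⟩
      1ℚ * (δ * c e * f T * 1/ κ)
        ≡⟨ cong (_* (δ * c e * f T * 1/ κ)) (sym (*-inverseʳ γ)) ⟩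
      γ * 1/ γ * (δ * c e * f T * 1/ κ)
        ≡⟨ solve 6 (λ g g⁻¹ d x F k⁻¹ → g :* g⁻¹ :* (d :* x :* F :* k⁻¹) := g :* (d :* g⁻¹ :* (F :* k⁻¹) :* x))
                   refl γ (1/ γ) δ (c e) (f T) (1/ κ) ⟩
      γ * (K * c e) ∎
      where open ≡-Reasoning
    gain≤ : Dec (e ∈ T′) → Covered T e → Δ f ⁅ e ⁆ T′ ≤ K * c e
    gain≤ (yes e∈T′) _ = subst (_≤ K * c e) (sym (Δ-⊆ f (x∈p⇒⁅x⁆⊆p e∈T′))) (0≤p*q (gainRate≥0 δ≥0 fT≥0) (c≥0 e))
    gain≤ (no e∉T′) (inj₁ e∈T) = contradiction (T⊆T′ e∈T) e∉T′
    gain≤ (no e∉T′) (inj₂ (B , B⊆T , ¬adm)) = *-cancelˡ-≤-pos γ (begin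
      γ * Δ f ⁅ e ⁆ T′           ≤⟨ ratio B T′ e (⊆-trans B⊆T T⊆T′) e∉T′ ⟩
      Δ f ⁅ e ⁆ B                ≤⟨ <⇒≤ (≰⇒> ¬adm) ⟩
      (δ * c e * f B) ÷ κ        ≤⟨ *-monoʳ-≤-nonNeg (1/ κ) {{nonNegative (1/pos≥0 κ)}}
                                      (*-monoˡ-≤-nonNeg (δ * c e) {{nonNegative (0≤p*q δ≥0 (c≥0 e))}} (mono B T B⊆T)) ⟩
      (δ * c e * f T) ÷ κ        ≡⟨ cancel-γ ⟩
      γ * (K * c e)              ∎)
      where open ≤-Reasoning

module QuickPruneRun {n} (f : Subset n → ℚ) (c : Fin n → ℚ) (κ δ ε : ℚ) (κ>0 : 0ℚ < κ) (ε>0 : 0ℚ < ε) where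

  instance
    κ-pos : Positive κ
    κ-pos = positive κ>0
    ε≢0 : NonZero ε
    ε≢0 = pos⇒nonZero ε {{positive ε>0}}

  open Threshold f c κ δ public

  Admits? : ∀ B e → Dec (Admits B e)
  Admits? B e = (δ * c e * f B) ÷ κ ≤? Δ f ⁅ e ⁆ B

  -- Aᵢ and aᵢᵢ are A and a* after steps (i) and (ii), and update performs step (iii); they
  -- restate the local definitions of step, so that next-unskipped holds by computation.
  Aᵢ : State n → Fin n → Subset n
  Aᵢ s e = if does (Admits? (A s) e) then A s ∪ ⁅ e ⁆ else A s

  aᵢᵢ : State n → Fin n → Subset n
  aᵢᵢ s e = if does (f (aStar s) <? f ⁅ e ⁆) then ⁅ e ⁆ else aStar s

  Prunes? : ∀ s e → Dec ((nℚ n ÷ ε) * f (As s) < f (Aᵢ s e))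
  Prunes? s e = (nℚ n ÷ ε) * f (As s) <? f (Aᵢ s e)

  update : State n → Fin n → State n
  update s e = if does (Prunes? s e)
    then st (Aᵢ s e ─ As s) (aᵢᵢ s e) (Aᵢ s e ─ As s) (Ahat s ∪ Aᵢ s e)
    else st (Aᵢ s e) (aᵢᵢ s e) (As s) (Ahat s ∪ Aᵢ s e)

  next : State n → Fin n → State n
  next = step f c κ δ ε κ>0 ε>0

  next-skipped : ∀ {s e} → κ < c e → next s e ≡ s
  next-skipped {s} {e} κ<ce = cong (λ b → if b then s else update s e) (dec-true (κ <? c e) κ<ce)

  next-unskipped : ∀ {s e} → c e ≤ κ → next s e ≡ update s e
  next-unskipped {s} {e} ce≤κ = cong (λ b → if b then s else update s e) (dec-false (κ <? c e) (≤⇒≯ ce≤κ))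

  Admits⇒∈Aᵢ : ∀ {s e} → Admits (A s) e → e ∈ Aᵢ s e
  Admits⇒∈Aᵢ {s} {e} adm = subst (λ b → e ∈ (if b then A s ∪ ⁅ e ⁆ else A s)) (sym (dec-true (Admits? (A s) e) adm))
                                 (q⊆p∪q (A s) ⁅ e ⁆ (x∈⁅x⁆ e))

  A-next⊆Aᵢ : ∀ {s e} → c e ≤ κ → A (next s e) ⊆ Aᵢ s e
  A-next⊆Aᵢ {s} {e} ce≤κ = subst (λ t → A t ⊆ Aᵢ s e) (sym (next-unskipped ce≤κ))
    (if-elim (λ t → A t ⊆ Aᵢ s e) (does (Prunes? s e)) (p─q⊆p (Aᵢ s e) (As s)) id)

  Ahat-next : ∀ {s e} → c e ≤ κ → Ahat (next s e) ≡ Ahat s ∪ Aᵢ s e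
  Ahat-next {s} {e} ce≤κ = trans (cong Ahat (next-unskipped ce≤κ))
    (if-elim (λ t → Ahat t ≡ Ahat s ∪ Aᵢ s e) (does (Prunes? s e)) refl refl)

  Ahat⊆Ahat-next : ∀ s e → Ahat s ⊆ Ahat (next s e)
  Ahat⊆Ahat-next s e with κ <? c e
  ... | yes κ<ce = ⊆-reflexive (cong Ahat (sym (next-skipped κ<ce)))
  ... | no  κ≮ce = subst (Ahat s ⊆_) (sym (Ahat-next (≮⇒≥ κ≮ce))) (p⊆p∪q (Aᵢ s e))

  A⊆Ahat-next : ∀ {s} e → A s ⊆ Ahat s → A (next s e) ⊆ Ahat (next s e)
  A⊆Ahat-next {s} e A⊆Ahat with κ <? c e
  ... | yes κ<ce = subst (λ t → A t ⊆ Ahat t) (sym (next-skipped κ<ce)) A⊆Ahat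
  ... | no  κ≮ce = subst (A (next s e) ⊆_) (sym (Ahat-next (≮⇒≥ κ≮ce)))
                     (⊆-trans (A-next⊆Aᵢ (≮⇒≥ κ≮ce)) (q⊆p∪q (Ahat s) (Aᵢ s e)))

  Covered-next : ∀ {s e} → A s ⊆ Ahat s → c e ≤ κ → Covered (Ahat (next s e)) e
  Covered-next {s} {e} A⊆Ahat ce≤κ with Admits? (A s) e
  ... | yes adm  = inj₁ (subst (e ∈_) (sym (Ahat-next ce≤κ)) (q⊆p∪q (Ahat s) (Aᵢ s e) (Admits⇒∈Aᵢ {s} adm)))
  ... | no  ¬adm = inj₂ (A s , ⊆-trans A⊆Ahat (Ahat⊆Ahat-next s e) , ¬adm)

  Ahat⊆Ahat-foldl : ∀ xs s → Ahat s ⊆ Ahat (foldl next s xs)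
  Ahat⊆Ahat-foldl []       s = id
  Ahat⊆Ahat-foldl (x ∷ xs) s = ⊆-trans (Ahat⊆Ahat-next s x) (Ahat⊆Ahat-foldl xs (next s x))

  Covered-foldl : ∀ {e} xs s → A s ⊆ Ahat s → e ∈ₗ xs → c e ≤ κ → Covered (Ahat (foldl next s xs)) e
  Covered-foldl (x ∷ xs) s A⊆Ahat (Any.here refl) ce≤κ =
    Covered-mono (Ahat⊆Ahat-foldl xs (next s x)) (Covered-next A⊆Ahat ce≤κ)
  Covered-foldl (x ∷ xs) s A⊆Ahat (Any.there e∈xs) ce≤κ =
    Covered-foldl xs (next s x) (A⊆Ahat-next x A⊆Ahat) e∈xs ce≤κ

  Covered-run : ∀ {e} → c e ≤ κ → Covered (Ahat-run f c κ δ ε κ>0 ε>0) e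
  Covered-run {e} = Covered-foldl (allFin n) initial id (∈-allFin e)

proposition4 : (n : ℕ) (f : Subset n → ℚ) (c : Fin n → ℚ) (γ κ δ ε : ℚ) →
  (∀ S → 0ℚ ≤ f S) → IsGammaSubmodular f γ → (γ>0 : 0ℚ < γ) →
  (∀ e → 0ℚ < c e) → (κ>0 : 0ℚ < κ) → 0ℚ < δ → (ε>0 : 0ℚ < ε) →
  ∀ S → cost c S ≤ κ →
  f S ≤ (1ℚ + (δ ÷ γ) {{pos⇒nonZero γ {{positive γ>0}}}}) * f (Ahat-run f c κ δ ε κ>0 ε>0)
proposition4 n f c γ κ δ ε f≥0 (mono , _ , _ , ratio , _) γ>0 c>0 κ>0 δ>0 ε>0 S cS≤κ = begin
  f S                       ≤⟨ mono S (Â ∪ S) (q⊆p∪q Â S) ⟩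
  f (Â ∪ S)                 ≡⟨ solve 2 (λ a b → a := b :+ (a :- b)) refl (f (Â ∪ S)) (f Â) ⟩
  f Â + Δ f S Â             ≤⟨ +-monoʳ-≤ (f Â) (Δ≤*cost f c K Â S gains) ⟩
  f Â + K * cost c S        ≤⟨ +-monoʳ-≤ (f Â) (*-monoˡ-≤-nonNeg K {{nonNegative (gainRate≥0 δ≥0 (f≥0 Â))}} cS≤κ) ⟩
  f Â + K * κ               ≡⟨ cong (f Â +_) (p*[q÷r]*r≡p*q (δ ÷ γ) (f Â) κ) ⟩
  f Â + (δ ÷ γ) * f Â       ≡⟨ solve 2 (λ F r → F :+ r :* F := (con 1ℚ :+ r) :* F) refl (f Â) (δ ÷ γ) ⟩
  (1ℚ + δ ÷ γ) * f Â        ∎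
  where
  open ≤-Reasoning
  open QuickPruneRun f c κ δ ε κ>0 ε>0
  instance
    γ-pos : Positive γ
    γ-pos = positive γ>0
    γ≢0 : NonZero γ
    γ≢0 = pos⇒nonZero γ
  Â : Subset n
  Â = Ahat-run f c κ δ ε κ>0 ε>0
  K : ℚ
  K = gainRate γ Â
  δ≥0 : 0ℚ ≤ δ
  δ≥0 = <⇒≤ δ>0
  c≥0 : ∀ e → 0ℚ ≤ c e
  c≥0 e = <⇒≤ (c>0 e)
  gains : CostBoundedGains f c K Â S
  gains = Covered⇒CostBoundedGains mono ratio δ≥0 (f≥0 Â) c≥0
            (λ e∈S → Covered-run (≤-trans (∈⇒≤cost c≥0 e∈S) cS≤κ))
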